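{- Run the peel-off phase of Algorithm PMR (defined in the context) with parameter $\gamma\ge 1$, and let $n\ell=|V_R|$ be the number of vertices peeled off. Then $\ell\le\frac{R}{2\gamma}$.
   Context: Instance: a finite set $V$ of $n$ vertices of $G=(V,E)$ with nonnegative weights $w_{i,j}=w_{j,i}$; $W=\sum_{(i,j)\in E}w_{i,j}>0$. Peel-off phase of Algorithm PMR: set $V_B\leftarrow V$, $E_B\leftarrow E$; while some $v\in V_B$ has $W_v=\sum_{u\in V_B,(v,u)\in E_B}w_{v,u}\ge\gamma\frac{2W}{n}$ (with the original $W$ and $n$, never updated), choose $v^*\in V_B$ with the largest $W_v$, remove $v^*$ from $V_B$ and remove all edges incident to $v^*$ from $E_B$. The removed vertices form $V_R$ (red vertices); red edges are the edges with at least one endpoint in $V_R$, of total weight $W_R$; $R=W_R/W$.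
   Formalization: The edge weights $w_{i,j}$ and the parameter γ take rational values. -}

module Defs where

open import Data.Bool using (Bool; true; false; if_then_else_; _∧_; _∨_; not; T)
open import Data.Nat as ℕ using (ℕ; zero; suc; _<ᵇ_)
open import Data.Integer using (+_)
open import Data.Fin using (Fin; toℕ; _≟_)
open import Data.List using (List; []; _∷_; length)
open import Data.Bool.ListAction using (any)
open import Data.Product using (_×_)
open import Relation.Binary.PropositionalEquality using (_≡_)
open import Relation.Nullary.Decidable using (⌊_⌋)
open import Data.Rational using (ℚ; 0ℚ; 1ℚ; _+_; _*_; _/_; _÷_; _≤_; _<_; positive; >-nonZero)
open import Data.Rational.Properties using (<-≤-trans; pos*pos⇒pos; positive⁻¹)

Σ : ∀ {n} → (Fin n → ℚ) → ℚ
Σ {zero}  f = 0ℚ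
Σ {suc n} f = f Data.Fin.zero + Σ (λ i → f (Data.Fin.suc i))

VSet : ℕ → Set
VSet n = Fin n → Bool

fullSet : ∀ {n} → VSet n
fullSet _ = true

remove : ∀ {n} → Fin n → VSet n → VSet n
remove v B u = if ⌊ u ≟ v ⌋ then false else B u

inList : ∀ {n} → Fin n → List (Fin n) → Bool
inList v vs = any (λ u → ⌊ u ≟ v ⌋) vs

record WGraph (n : ℕ) : Set where
  field
    adj      : Fin n → Fin n → Bool
    w        : Fin n → Fin n → ℚ
    adj-sym  : ∀ i j → adj i j ≡ adj j i
    adj-irr  : ∀ i → adj i i ≡ false
    w-sym    : ∀ i j → w i j ≡ w j i
    w-nonneg : ∀ i j → 0ℚ ≤ w i j

module _ {n : ℕ} (G : WGraph n) where
  open WGraph G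

  -- weight of an unordered edge {i,j} counted once (i < j), if it is an edge
  -- and satisfies the extra selector p
  edgeW : (Fin n → Fin n → Bool) → Fin n → Fin n → ℚ
  edgeW p i j = if adj i j ∧ (toℕ i <ᵇ toℕ j) ∧ p i j then w i j else 0ℚ

  totalW : ℚ
  totalW = Σ λ i → Σ λ j → edgeW (λ _ _ → true) i j

  degW : VSet n → Fin n → ℚ
  degW B v = Σ λ u → if B u ∧ adj v u then w v u else 0ℚ

  -- Peel threshold γ · 2W/n (original W and n)
  threshold : .{{_ : ℕ.NonZero n}} → ℚ → ℚ
  threshold γ = γ * ((+ 2 / 1) * totalW * (+ 1 / n))

  -- PeelRun γ B vs : starting from current vertex set B (with E_B the edges
  -- of E inside B), the peel-off loop removes exactly the vertices vs, in order,
  -- and then stops.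
  PeelRun : .{{_ : ℕ.NonZero n}} → ℚ → VSet n → List (Fin n) → Set
  PeelRun γ B [] = ∀ v → T (B v) → degW B v < threshold γ
  PeelRun γ B (v ∷ vs) =
    T (B v) × threshold γ ≤ degW B v ×
    (∀ u → T (B u) → degW B u ≤ degW B v) ×
    PeelRun γ (remove v B) vs

  redW : List (Fin n) → ℚ
  redW VR = Σ λ i → Σ λ j → edgeW (λ a b → inList a VR ∨ inList b VR) i j

  ell : .{{_ : ℕ.NonZero n}} → List (Fin n) → ℚ
  ell VR = + length VR / n

  ratioR : List (Fin n) → 0ℚ < totalW → ℚ
  ratioR VR W>0 = _÷_ (redW VR) totalW {{>-nonZero W>0}}

twoγ>0 : ∀ γ → 1ℚ ≤ γ → 0ℚ < (+ 2 / 1) * γ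
twoγ>0 γ 1≤γ = positive⁻¹ ((+ 2 / 1) * γ) {{pos*pos⇒pos (+ 2 / 1) γ {{positive (<-≤-trans (positive⁻¹ 1ℚ) 1≤γ)}}}}

over2γ : (x γ : ℚ) → 1ℚ ≤ γ → ℚ
over2γ x γ 1≤γ = _÷_ x ((+ 2 / 1) * γ) {{>-nonZero (twoγ>0 γ 1≤γ)}}

{-# OPTIONS --safe #-}
module Submission where

open import Defs
open import Data.Nat using (ℕ; NonZero)
open import Data.Fin using (Fin)
open import Data.List using (List)
open import Data.Rational using (ℚ; 0ℚ; 1ℚ; _≤_; _<_)

open import Data.Bool using (Bool; true; false; if_then_else_; _∧_; _∨_; T)
open import Data.Bool.Properties using (∧-identityʳ; ∧-zeroʳ; ∨-zeroʳ)
open import Data.Empty using (⊥-elim)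
open import Data.Fin using (zero; suc; toℕ; _≟_)
import Data.Fin.Properties as Fin
open import Data.Integer using (+_)
import Data.Integer as ℤ
import Data.Integer.Properties as ℤ
open import Data.List using ([]; _∷_; length)
open import Data.Nat using (zero; suc; _<ᵇ_)
import Data.Nat.Properties as ℕ
open import Data.Product using (_,_)
open import Data.Rational as ℚ using (_+_; _*_; _÷_; 1/_; _/_; fromℚᵘ; Positive)
import Data.Rational.Properties as ℚ
open import Algebra.Properties.CommutativeMonoid.Sum ℚ.+-0-commutativeMonoid
  using (sum; ∑-distrib-+; sum-replicate-zero)
open import Data.Rational.Solver using (module +-*-Solver)
import Data.Rational.Unnormalised as ℚᵘ
import Data.Rational.Unnormalised.Properties as ℚᵘ
open import Data.Unit using (tt)
open import Function using (_∘_)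
open import Relation.Binary.PropositionalEquality
open import Relation.Nullary using (contradiction)
open import Relation.Nullary.Decidable using (⌊_⌋; yes; no; ⌊⌋-map′; toWitness)
open import Relation.Nullary.Reflects using (ofʸ; ofⁿ)

-- Write F(B, vs) for the weight of the edges of the induced subgraph G[B] that meet vs.
-- Peeling v from B splits the edges of G[B] meeting v ∷ vs into those at v, of weight
-- W_v(B), and those of G[B ∖ v] meeting vs: F(B, v ∷ vs) = W_v(B) + F(B ∖ v, vs).
-- Every peeled vertex passes the threshold test W_v ≥ γ·2W/n, so along the run
-- |V_R| · γ·2W/n ≤ F(V, V_R) = W_R, which is ℓ ≤ R/(2γ) after dividing by 2γW.

infixr 7 [_]·_

[_]·_ : Bool → ℚ → ℚ
[ b ]· x = if b then x else 0ℚ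

[]·-nonneg : ∀ b {x} → 0ℚ ≤ x → 0ℚ ≤ [ b ]· x
[]·-nonneg true  0≤x = 0≤x
[]·-nonneg false _   = ℚ.≤-refl

[]·-zero : ∀ b → [ b ]· 0ℚ ≡ 0ℚ
[]·-zero true  = refl
[]·-zero false = refl

Σ≡sum : ∀ {n} (f : Fin n → ℚ) → Σ f ≡ sum f
Σ≡sum {zero}  f = refl
Σ≡sum {suc n} f = cong (_+_ (f zero)) (Σ≡sum (λ i → f (suc i)))

Σ-cong : ∀ {n} {f g : Fin n → ℚ} → (∀ i → f i ≡ g i) → Σ f ≡ Σ g
Σ-cong {zero}  f≗g = refl
Σ-cong {suc n} f≗g = cong₂ _+_ (f≗g zero) (Σ-cong (λ i → f≗g (suc i)))

Σ-distrib-+ : ∀ {n} (f g : Fin n → ℚ) → Σ (λ i → f i + g i) ≡ Σ f + Σ g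
Σ-distrib-+ f g = begin
  Σ (λ i → f i + g i)   ≡⟨ Σ≡sum (λ i → f i + g i) ⟩
  sum (λ i → f i + g i) ≡⟨ ∑-distrib-+ f g ⟩
  sum f + sum g         ≡⟨ cong₂ _+_ (Σ≡sum f) (Σ≡sum g) ⟨
  Σ f + Σ g             ∎
  where open ≡-Reasoning

Σ²-distrib-+ : ∀ {m n} (f g : Fin m → Fin n → ℚ) →
  Σ (λ i → Σ λ j → f i j + g i j) ≡ Σ (λ i → Σ (f i)) + Σ (λ i → Σ (g i))
Σ²-distrib-+ f g = trans (Σ-cong (λ i → Σ-distrib-+ (f i) (g i)))
                         (Σ-distrib-+ (λ i → Σ (f i)) (λ i → Σ (g i)))

Σ-zero : ∀ n → Σ {n} (λ _ → 0ℚ) ≡ 0ℚ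
Σ-zero n = trans (Σ≡sum {n} (λ _ → 0ℚ)) (sum-replicate-zero n)

Σ-[]· : ∀ {n} b (f : Fin n → ℚ) → Σ (λ i → [ b ]· f i) ≡ [ b ]· Σ f
Σ-[]· true  f = refl
Σ-[]· {n} false f = Σ-zero n

Σ-δ : ∀ {n} (v : Fin n) (f : Fin n → ℚ) → Σ (λ i → [ ⌊ i ≟ v ⌋ ]· f i) ≡ f v
Σ-δ {suc n} zero f = trans (cong (_+_ (f zero)) (Σ-zero n)) (ℚ.+-identityʳ _)
Σ-δ {suc n} (suc v) f = begin
  0ℚ + Σ (λ i → [ ⌊ suc i ≟ suc v ⌋ ]· f (suc i))
    -- ⌊_⌋ is isYes, which does not compute through the map′ in suc i ≟ suc v
    ≡⟨ cong (_+_ 0ℚ) (Σ-cong (λ i → cong ([_]· f (suc i)) (⌊⌋-map′ _ _ (i ≟ v)))) ⟩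
  0ℚ + Σ (λ i → [ ⌊ i ≟ v ⌋ ]· f (suc i))
    ≡⟨ cong (_+_ 0ℚ) (Σ-δ v (λ i → f (suc i))) ⟩
  0ℚ + f (suc v)
    ≡⟨ ℚ.+-identityˡ _ ⟩
  f (suc v) ∎
  where open ≡-Reasoning

Σ-nonneg : ∀ {n} (f : Fin n → ℚ) → (∀ i → 0ℚ ≤ f i) → 0ℚ ≤ Σ f
Σ-nonneg {zero}  f 0≤f = ℚ.≤-refl
Σ-nonneg {suc n} f 0≤f = ℚ.+-mono-≤ (0≤f zero) (Σ-nonneg (λ i → f (suc i)) (λ i → 0≤f (suc i)))

fromℚᵘ-homo-+ : ∀ p q → fromℚᵘ (p ℚᵘ.+ q) ≡ fromℚᵘ p + fromℚᵘ q
fromℚᵘ-homo-+ p q = ℚ.toℚᵘ-injective (ℚᵘ.≃-trans (ℚ.toℚᵘ-fromℚᵘ (p ℚᵘ.+ q))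
  (ℚᵘ.≃-sym (ℚᵘ.≃-trans (ℚ.toℚᵘ-homo-+ (fromℚᵘ p) (fromℚᵘ q))
    (ℚᵘ.+-cong (ℚ.toℚᵘ-fromℚᵘ p) (ℚ.toℚᵘ-fromℚᵘ q)))))

fromℚᵘ-homo-* : ∀ p q → fromℚᵘ (p ℚᵘ.* q) ≡ fromℚᵘ p * fromℚᵘ q
fromℚᵘ-homo-* p q = ℚ.toℚᵘ-injective (ℚᵘ.≃-trans (ℚ.toℚᵘ-fromℚᵘ (p ℚᵘ.* q))
  (ℚᵘ.≃-sym (ℚᵘ.≃-trans (ℚ.toℚᵘ-homo-* (fromℚᵘ p) (fromℚᵘ q))
    (ℚᵘ.*-cong (ℚ.toℚᵘ-fromℚᵘ p) (ℚ.toℚᵘ-fromℚᵘ q)))))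

suc/1≡1+/1 : ∀ k → + suc k / 1 ≡ 1ℚ + + k / 1
suc/1≡1+/1 k = trans (ℚ./-cong (cong (ℤ._+_ (+ 1)) (sym (ℤ.*-identityʳ (+ k)))) refl)
                     (fromℚᵘ-homo-+ (ℚᵘ.mkℚᵘ (+ 1) 0) (ℚᵘ.mkℚᵘ (+ k) 0))

/≡/1*1/ : ∀ i n .{{_ : NonZero n}} → i / n ≡ (i / 1) * (+ 1 / n)
/≡/1*1/ i (suc m) = trans (ℚ./-cong (sym (ℤ.*-identityʳ i)) (sym (ℕ.*-identityˡ (suc m))))
                    (fromℚᵘ-homo-* (ℚᵘ.mkℚᵘ i 0) (ℚᵘ.mkℚᵘ (+ 1) m))

*≤⇒≤÷ : ∀ {a b} c .{{_ : Positive c}} → a * c ≤ b → a ≤ (b ÷ c) {{ℚ.pos⇒nonZero c}}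
*≤⇒≤÷ {a} {b} c ac≤b = begin
  a                  ≡⟨ a≡ac/c ⟨
  a * c * 1/c        ≤⟨ ℚ.*-monoʳ-≤-nonNeg 1/c {{ℚ.pos⇒nonNeg 1/c {{ℚ.1/pos⇒pos c}}}} ac≤b ⟩
  b * 1/c            ∎
  where
  open ℚ.≤-Reasoning
  1/c : ℚ
  1/c = (1/ c) {{ℚ.pos⇒nonZero c}}
  a≡ac/c : a * c * 1/c ≡ a
  a≡ac/c = trans (ℚ.*-assoc a c 1/c)
             (trans (cong (a *_) (ℚ.*-inverseʳ c {{ℚ.pos⇒nonZero c}})) (ℚ.*-identityʳ a))

⌊≟⌋-sym : ∀ {n} (i j : Fin n) → ⌊ i ≟ j ⌋ ≡ ⌊ j ≟ i ⌋
⌊≟⌋-sym i j with i ≟ j | j ≟ i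
... | yes _   | yes _   = refl
... | no _    | no _    = refl
... | yes i≡j | no j≢i  = contradiction (sym i≡j) j≢i
... | no i≢j  | yes j≡i = contradiction (sym j≡i) i≢j

-- p, q: whether the endpoints i, j are the peeled vertex; bi, bj: whether they are in B;
-- ti, tj: whether they are among the vertices peeled later.
[]·-peel : ∀ p q bi bj ti tj x →
  (T p → T bi) → (T q → T bj) → (T p → T q → x ≡ 0ℚ) →
  [ bi ∧ bj ∧ ((p ∨ ti) ∨ (q ∨ tj)) ]· x ≡
  ([ p ]· [ bj ]· x + [ q ]· [ bi ]· x)
    + [ (if p then false else bi) ∧ (if q then false else bj) ∧ (ti ∨ tj) ]· x
[]·-peel false false bi bj    ti tj x _    _    _ = sym (ℚ.+-identityˡ _)
[]·-peel true  false false bj ti tj x p⇒bi _    _ = ⊥-elim (p⇒bi tt)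
[]·-peel true  false true bj  ti tj x _    _    _ rewrite ∧-identityʳ bj =
  sym (trans (ℚ.+-identityʳ _) (ℚ.+-identityʳ _))
[]·-peel false true bi false  ti tj x _    q⇒bj _ = ⊥-elim (q⇒bj tt)
[]·-peel false true bi true   ti tj x _    _    _
  rewrite ∨-zeroʳ ti | ∧-identityʳ bi | ∧-zeroʳ bi =
  sym (trans (ℚ.+-identityʳ _) (ℚ.+-identityˡ _))
[]·-peel true  true bi bj     ti tj x _    _    x≡0
  rewrite x≡0 tt tt | []·-zero (bi ∧ bj ∧ true) | []·-zero bj | []·-zero bi = refl

touches : ∀ {n} → List (Fin n) → Fin n → Fin n → Bool
touches vs i j = inList i vs ∨ inList j vs

module _ {n : ℕ} (G : WGraph n) where
  open WGraph G

  orientedW : Fin n → Fin n → ℚ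
  orientedW i j = [ adj i j ∧ (toℕ i <ᵇ toℕ j) ]· w i j

  inducedRedW : VSet n → List (Fin n) → ℚ
  inducedRedW B vs = Σ λ i → Σ λ j → [ B i ∧ B j ∧ touches vs i j ]· orientedW i j

  orientedW-nonneg : ∀ i j → 0ℚ ≤ orientedW i j
  orientedW-nonneg i j = []·-nonneg _ (w-nonneg i j)

  orientedW-diag : ∀ v → orientedW v v ≡ 0ℚ
  orientedW-diag v = cong (λ a → [ a ∧ (toℕ v <ᵇ toℕ v) ]· w v v) (adj-irr v)

  orientedW-flip : ∀ u v → orientedW u v + orientedW v u ≡ [ adj u v ]· w u v
  orientedW-flip u v rewrite adj-sym v u | w-sym v u
    with adj u v in uv | toℕ u <ᵇ toℕ v | ℕ.<ᵇ-reflects-< (toℕ u) (toℕ v)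
                       | toℕ v <ᵇ toℕ u | ℕ.<ᵇ-reflects-< (toℕ v) (toℕ u)
  ... | false | _     | _        | _     | _        = refl
  ... | true  | true  | ofʸ u<v  | true  | ofʸ v<u  = contradiction v<u (ℕ.<-asym u<v)
  ... | true  | true  | _        | false | _        = ℚ.+-identityʳ _
  ... | true  | false | _        | true  | _        = ℚ.+-identityˡ _
  ... | true  | false | ofⁿ u≮v  | false | ofⁿ v≮u
    with refl ← Fin.toℕ-injective (ℕ.≤-antisym (ℕ.≮⇒≥ v≮u) (ℕ.≮⇒≥ u≮v))
    with () ← trans (sym uv) (adj-irr u)

  inducedRedW-nonneg : ∀ B vs → 0ℚ ≤ inducedRedW B vs
  inducedRedW-nonneg B vs =
    Σ-nonneg _ (λ i → Σ-nonneg _ (λ j →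
      []·-nonneg (B i ∧ B j ∧ touches vs i j) (orientedW-nonneg i j)))

  edgeW≡[]·orientedW : ∀ p i j → edgeW G p i j ≡ [ p i j ]· orientedW i j
  edgeW≡[]·orientedW p i j with adj i j | toℕ i <ᵇ toℕ j
  ... | true  | true  = refl
  ... | true  | false = sym ([]·-zero (p i j))
  ... | false | _     = sym ([]·-zero (p i j))

  redW≡inducedRedW-fullSet : ∀ vs → redW G vs ≡ inducedRedW fullSet vs
  redW≡inducedRedW-fullSet vs = Σ-cong (λ i → Σ-cong (edgeW≡[]·orientedW (touches vs) i))

  peel-split : ∀ B v vs → T (B v) → ∀ i j →
    [ B i ∧ B j ∧ touches (v ∷ vs) i j ]· orientedW i j ≡
    ([ ⌊ i ≟ v ⌋ ]· [ B j ]· orientedW i j + [ ⌊ j ≟ v ⌋ ]· [ B i ]· orientedW i j)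
      + [ remove v B i ∧ remove v B j ∧ touches vs i j ]· orientedW i j
  -- inList i (v ∷ vs) tests v ≟ i, whereas remove v B i tests i ≟ v.
  peel-split B v vs Bv i j rewrite ⌊≟⌋-sym v i | ⌊≟⌋-sym v j =
    []·-peel ⌊ i ≟ v ⌋ ⌊ j ≟ v ⌋ (B i) (B j) (inList i vs) (inList j vs) (orientedW i j)
      (λ i≡v → subst (T ∘ B) (sym (toWitness i≡v)) Bv)
      (λ j≡v → subst (T ∘ B) (sym (toWitness j≡v)) Bv)
      (λ i≡v j≡v → trans (cong₂ orientedW (toWitness i≡v) (toWitness j≡v)) (orientedW-diag v))

  inducedRedW-peel : ∀ B v vs → T (B v) →
    inducedRedW B (v ∷ vs) ≡ degW G B v + inducedRedW (remove v B) vs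
  inducedRedW-peel B v vs Bv = begin
    inducedRedW B (v ∷ vs)
      ≡⟨ Σ-cong (λ i → Σ-cong (peel-split B v vs Bv i)) ⟩
    Σ (λ i → Σ λ j → (fromV i j + toV i j) + rest i j)
      ≡⟨ Σ²-distrib-+ (λ i j → fromV i j + toV i j) rest ⟩
    Σ (λ i → Σ λ j → fromV i j + toV i j) + inducedRedW (remove v B) vs
      ≡⟨ cong (_+ inducedRedW (remove v B) vs) edges-at-v≡degW ⟩
    degW G B v + inducedRedW (remove v B) vs ∎
    where
    open ≡-Reasoning
    fromV toV rest : Fin n → Fin n → ℚ
    fromV i j = [ ⌊ i ≟ v ⌋ ]· [ B j ]· orientedW i j
    toV   i j = [ ⌊ j ≟ v ⌋ ]· [ B i ]· orientedW i j
    rest  i j = [ remove v B i ∧ remove v B j ∧ touches vs i j ]· orientedW i j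

    degW-term : ∀ u → [ B u ]· orientedW v u + [ B u ]· orientedW u v ≡ [ B u ∧ adj v u ]· w v u
    degW-term u with B u
    ... | true  = orientedW-flip v u
    ... | false = refl

    edges-at-v≡degW : Σ (λ i → Σ λ j → fromV i j + toV i j) ≡ degW G B v
    edges-at-v≡degW = begin
      Σ (λ i → Σ λ j → fromV i j + toV i j)
        ≡⟨ Σ²-distrib-+ fromV toV ⟩
      Σ (λ i → Σ (fromV i)) + Σ (λ i → Σ (toV i))
        ≡⟨ cong₂ _+_ (trans (Σ-cong (λ i → Σ-[]· ⌊ i ≟ v ⌋ (λ j → [ B j ]· orientedW i j)))
                            (Σ-δ v (λ i → Σ λ j → [ B j ]· orientedW i j)))
                     (Σ-cong (λ i → Σ-δ v (λ j → [ B i ]· orientedW i j))) ⟩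
      Σ (λ u → [ B u ]· orientedW v u) + Σ (λ u → [ B u ]· orientedW u v)
        ≡⟨ Σ-distrib-+ (λ u → [ B u ]· orientedW v u) (λ u → [ B u ]· orientedW u v) ⟨
      Σ (λ u → [ B u ]· orientedW v u + [ B u ]· orientedW u v)
        ≡⟨ Σ-cong degW-term ⟩
      degW G B v ∎

  module _ .{{_ : NonZero n}} (γ : ℚ) where

    length*threshold≤inducedRedW : ∀ B vs → PeelRun G γ B vs →
      (+ length vs / 1) * threshold G γ ≤ inducedRedW B vs
    length*threshold≤inducedRedW B [] _ =
      ℚ.≤-trans (ℚ.≤-reflexive (ℚ.*-zeroˡ (threshold G γ))) (inducedRedW-nonneg B [])
    length*threshold≤inducedRedW B (v ∷ vs) (Bv , θ≤degW , _ , run) = begin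
      (+ suc (length vs) / 1) * θ        ≡⟨ cong (_* θ) (suc/1≡1+/1 (length vs)) ⟩
      (1ℚ + + length vs / 1) * θ          ≡⟨ ℚ.*-distribʳ-+ θ 1ℚ (+ length vs / 1) ⟩
      1ℚ * θ + (+ length vs / 1) * θ      ≡⟨ cong (_+ (+ length vs / 1) * θ) (ℚ.*-identityˡ θ) ⟩
      θ + (+ length vs / 1) * θ
        ≤⟨ ℚ.+-mono-≤ θ≤degW (length*threshold≤inducedRedW (remove v B) vs run) ⟩
      degW G B v + inducedRedW (remove v B) vs ≡⟨ inducedRedW-peel B v vs Bv ⟨
      inducedRedW B (v ∷ vs)              ∎
      where
      open ℚ.≤-Reasoning
      θ : ℚ
      θ = threshold G γ

lemma1 : (n : ℕ) .{{_ : NonZero n}} (G : WGraph n) (γ : ℚ) (1≤γ : 1ℚ ≤ γ)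
         (W>0 : 0ℚ < totalW G) (VR : List (Fin n)) →
         PeelRun G γ fullSet VR →
         ell G VR ≤ over2γ (ratioR G VR W>0) γ 1≤γ
lemma1 n G γ 1≤γ W>0 VR run =
  *≤⇒≤÷ 2γ {{ℚ.positive (twoγ>0 γ 1≤γ)}} (*≤⇒≤÷ W {{ℚ.positive W>0}} (begin
    ell G VR * 2γ * W                ≡⟨ cong (λ ℓ → ℓ * 2γ * W) (/≡/1*1/ K n) ⟩
    (K / 1) * (+ 1 / n) * 2γ * W     ≡⟨ rearrange (K / 1) (+ 1 / n) (+ 2 / 1) γ W ⟩
    (K / 1) * threshold G γ          ≤⟨ length*threshold≤inducedRedW G γ fullSet VR run ⟩
    inducedRedW G fullSet VR         ≡⟨ redW≡inducedRedW-fullSet G VR ⟨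
    redW G VR                        ∎))
  where
  open ℚ.≤-Reasoning
  K : ℤ.ℤ
  K = + length VR
  W 2γ : ℚ
  W = totalW G
  2γ = (+ 2 / 1) * γ
  rearrange : ∀ k m t γ W → k * m * (t * γ) * W ≡ k * (γ * (t * W * m))
  rearrange = solve 5 (λ k m t γ W → k :* m :* (t :* γ) :* W := k :* (γ :* (t :* W :* m))) refl
    where open +-*-Solver
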